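{- Let $G$ be a $2$-good graph on $n$ vertices with $3 \mid e(G)$ such that every vertex of $G$ has degree $\equiv 1 \pmod 3$. Then $R(G, \mathbb{Z}_3) = n + 2$.
   Context: A graph $G$ (not necessarily connected) is $2$-good if it has at least $2$ vertices of degree $1$ that are pairwise at distance at least three apart (vertices in different components are at infinite distance). For a graph $G$ on $n$ vertices with $3 \mid e(G)$, $R(G, \mathbb{Z}_3)$ is the smallest positive integer such that for every $N \geq R(G,\mathbb{Z}_3)$ and every edge-colouring $f\colon E(K_N) \to \mathbb{Z}_3$, there is a subgraph of $K_N$ isomorphic to $G$ whose edge colours sum to $0$ in $\mathbb{Z}_3$. -}

module Defs where

open import Data.Nat using (ℕ; zero; suc; _≤_; _<_; _%_)
open import Data.Bool using (Bool; true; false; if_then_else_; _∧_)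
open import Data.Fin using (Fin; toℕ; _<?_)
open import Data.List using (List; map; allFin)
open import Data.Nat.ListAction using (sum)
open import Data.Product using (Σ; _×_; ∃)
open import Relation.Nullary using (¬_; ⌊_⌋)
open import Relation.Binary.PropositionalEquality using (_≡_; _≢_)
open import Function.Definitions using (Injective)

record Graph (n : ℕ) : Set where
  field
    adj   : Fin n → Fin n → Bool
    sym   : ∀ i j → adj i j ≡ adj j i
    loopless : ∀ i → adj i i ≡ false
open Graph public

Adj : ∀ {n} → Graph n → Fin n → Fin n → Set
Adj G i j = adj G i j ≡ true

degree : ∀ {n} → Graph n → Fin n → ℕ
degree {n} G v = sum (map (λ j → if adj G v j then 1 else 0) (allFin n))

edgeSum : ∀ {n} → Graph n → (Fin n → Fin n → ℕ) → ℕ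
edgeSum {n} G w =
  sum (map (λ i → sum (map (λ j → if ⌊ i <? j ⌋ ∧ adj G i j then w i j else 0)
                           (allFin n)))
           (allFin n))

edgeCount : ∀ {n} → Graph n → ℕ
edgeCount G = edgeSum G (λ _ _ → 1)

DistAtLeast3 : ∀ {n} → Graph n → Fin n → Fin n → Set
DistAtLeast3 {n} G u v =
  (u ≢ v) × (¬ Adj G u v) × (¬ Σ (Fin n) (λ w → Adj G u w × Adj G w v))

TwoGood : ∀ {n} → Graph n → Set
TwoGood {n} G = Σ (Fin n) λ u → Σ (Fin n) λ v →
  (degree G u ≡ 1) × (degree G v ≡ 1) × DistAtLeast3 G u v

-- An edge-colouring of K_N with values in ℤ₃ = Fin 3, given as a
-- symmetric function (diagonal values are irrelevant).
Colouring : ℕ → Set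
Colouring N = Σ (Fin N → Fin N → Fin 3) λ c → ∀ i j → c i j ≡ c j i

ZeroSumCopy : ∀ {n} → Graph n → (N : ℕ) → (Fin N → Fin N → Fin 3) → Set
ZeroSumCopy {n} G N c =
  Σ (Fin n → Fin N) λ φ →
    Injective _≡_ _≡_ φ × (edgeSum G (λ i j → toℕ (c (φ i) (φ j))) % 3 ≡ 0)

RThreshold : ∀ {n} → Graph n → ℕ → Set
RThreshold G r = ∀ N → r ≤ N → (c : Colouring N) → ZeroSumCopy G N (Σ.proj₁ c)

IsRZ3 : ∀ {n} → Graph n → ℕ → Set
IsRZ3 G r = (0 < r) × RThreshold G r × (∀ r′ → 0 < r′ → RThreshold G r′ → r ≤ r′)

-- If all edges avoiding some two vertices share a
-- colour k, any copy of G placed there has sum k·e(G) ≡ 0.  Otherwise (N ≥ 6) there are two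
-- vertex-disjoint bichromatic cherries (a; x₁, x₂) and (b; y₁, y₂).  Embed G so that the pendant
-- edges uu′, vv′ of the two far-apart leaves land on ax₁ and by₁ and the image avoids x₂, y₂.
-- Moving u to x₂ and/or v to y₂ changes only these two edges, so the four copies have sums
-- S + αᵢ + βⱼ with α₁ ≠ α₂ and β₁ ≠ β₂, and one of them vanishes in ℤ₃.
--
-- Colour each edge of K_{n+1} by the number of its endpoints among two marked
-- vertices.  A copy φ of G has sum Σᵥ deg v · [φ v marked] ≡ #{v | φ v marked} (mod 3) since every
-- degree is ≡ 1, and n vertices injected into n + 1 hit one or two marked vertices.

module Submission where

open import Defs hiding (sym)

open import Data.Bool using (Bool; true; false; if_then_else_; _∧_; _∨_)
open import Data.Fin using (Fin; zero; suc; toℕ; fromℕ<; inject≤; punchIn; _<?_)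
open import Data.Fin.Permutation.Components using (transpose; transpose-inverse)
open import Data.Fin.Properties
  using (_≟_; punchInᵢ≢i; toℕ-injective; toℕ-fromℕ<; toℕ-inject≤; inject≤-injective; toℕ<n;
         injective⇒≤; any?; all?)
open import Data.List using (List; []; _∷_; map; allFin; tabulate; length; lookup)
open import Data.List.Membership.Propositional using (_∈_)
open import Data.List.Membership.Propositional.Properties using (∈-lookup)
open import Data.List.Properties using (map-tabulate; length-map)
open import Data.List.Relation.Binary.Pointwise using (Pointwise; []; _∷_)
open import Data.List.Relation.Unary.All as All using (All; []; _∷_)
open import Data.List.Relation.Unary.All.Properties as All using (¬Any⇒All¬)
open import Data.List.Relation.Unary.AllPairs as AllPairs using (AllPairs; []; _∷_)
import Data.List.Relation.Unary.AllPairs.Properties as AllPairs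
open import Data.List.Relation.Unary.Any as Any using ()
open import Data.List.Relation.Unary.Any.Properties using (lookup-index)
open import Data.Nat using (ℕ; zero; suc; _+_; _*_; _%_; _≤_; _<_; z≤n; s≤s; s≤s⁻¹; NonZero)
open import Data.Nat.DivMod using (_mod_; m%n<n; m%n%n≡m%n; %-distribˡ-+; %-distribˡ-*)
open import Data.Nat.ListAction using (sum)
open import Data.Nat.Properties
  using (+-*-semiring; +-comm; +-assoc; +-identityʳ; *-comm; *-identityˡ; *-identityʳ; *-zeroʳ;
         *-distribˡ-+; *-distribʳ-+; ≤-refl; ≤-reflexive; ≤-trans; ≤-antisym; <-asym; <⇒≤; <⇒≢;
         <⇒≱; ≮⇒≥; m≤m+n; m≤n+m; n≤1+n; n<1+n; 1+n≰n; +-mono-≤; +-monoˡ-≤)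
import Data.Nat.Properties as ℕ
open import Data.Product using (Σ-syntax; ∃; ∃₂; _×_; _,_; proj₁; proj₂)
open import Data.Sum using (_⊎_; inj₁; inj₂)
open import Data.Unit using (tt)
open import Data.Vec.Functional as V using (updateAt)
open import Data.Vec.Functional.Properties using (updateAt-updates; updateAt-minimal)
open import Function using (_∘_; id; const)
open import Function.Definitions using (Injective)
open import Level using (0ℓ)
open import Relation.Binary.Definitions using (DecidableEquality)
open import Relation.Binary.PropositionalEquality
open import Relation.Nullary using (¬_; ¬?; Dec; ⌊_⌋; yes; no; contradiction)
open import Relation.Nullary.Decidable
  using (True; dec-true; dec-false; toWitness; decidable-stable; _→-dec_; _×-dec_)
open import Relation.Unary using (Pred; Decidable; U)
open import Algebra.Properties.Semiring.Sum +-*-semiring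
  using (sum-syntax; ∑-distrib-+; ∑-comm; *-distribˡ-sum; *-distribʳ-sum; sum-cong-≗; sum-remove;
         sum-replicate-zero)
  renaming (sum to ∑)

𝟙 : Bool → ℕ
𝟙 b = if b then 1 else 0

∑-allFin : ∀ {n} (h : Fin n → ℕ) → sum (map h (allFin n)) ≡ ∑[ i < n ] h i
∑-allFin {zero}  h = refl
∑-allFin {suc n} h = cong (h zero +_) (begin
  sum (map h (tabulate suc))      ≡⟨ cong sum (map-tabulate suc h) ⟩
  sum (tabulate (h ∘ suc))        ≡⟨ cong sum (map-tabulate id (h ∘ suc)) ⟨
  sum (map (h ∘ suc) (allFin n))  ≡⟨ ∑-allFin (h ∘ suc) ⟩
  ∑[ i < n ] h (suc i)            ∎)
  where open ≡-Reasoning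

∑-zero : ∀ {n} (h : Fin n → ℕ) → (∀ i → h i ≡ 0) → ∑[ i < n ] h i ≡ 0
∑-zero {n} h h≡0 = trans (sum-cong-≗ h≡0) (sum-replicate-zero n)

∑-single : ∀ {n} (h : Fin n → ℕ) (p : Fin n) → (∀ i → i ≢ p → h i ≡ 0) → ∑[ i < n ] h i ≡ h p
∑-single {suc n} h p h≡0 = begin
  ∑ h                              ≡⟨ sum-remove {i = p} h ⟩
  h p + ∑[ k < n ] h (punchIn p k)  ≡⟨ cong (h p +_) (∑-zero _ (λ k → h≡0 _ (punchInᵢ≢i p k))) ⟩
  h p + 0                          ≡⟨ +-identityʳ (h p) ⟩
  h p                              ∎
  where open ≡-Reasoning

term≤∑ : ∀ {n} (h : Fin n → ℕ) (p : Fin n) → h p ≤ ∑[ i < n ] h i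
term≤∑ {suc n} h p = subst (h p ≤_) (sym (sum-remove {i = p} h)) (m≤m+n (h p) _)

∑-cong-% : ∀ {n} (m : ℕ) .{{_ : NonZero m}} (f g : Fin n → ℕ) → (∀ i → f i % m ≡ g i % m) →
           (∑[ i < n ] f i) % m ≡ (∑[ i < n ] g i) % m
∑-cong-% {zero}  m f g f≡g = refl
∑-cong-% {suc n} m f g f≡g = begin
  (f zero + ∑ (f ∘ suc)) % m
    ≡⟨ %-distribˡ-+ (f zero) _ m ⟩
  (f zero % m + ∑ (f ∘ suc) % m) % m
    ≡⟨ cong₂ (λ a b → (a + b) % m) (f≡g zero) (∑-cong-% m (f ∘ suc) (g ∘ suc) (f≡g ∘ suc)) ⟩
  (g zero % m + ∑ (g ∘ suc) % m) % m
    ≡⟨ %-distribˡ-+ (g zero) _ m ⟨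
  (g zero + ∑ (g ∘ suc)) % m
    ∎
  where open ≡-Reasoning

∑-𝟙≡1 : ∀ {n} (b : Fin n → Bool) → ∑[ i < n ] 𝟙 (b i) ≡ 1 →
        ∃ λ p → b p ≡ true × ∀ i → b i ≡ true → i ≡ p
∑-𝟙≡1 {suc n} b = split (b zero) refl
  where
    split : ∀ b₀ → b zero ≡ b₀ → 𝟙 b₀ + ∑[ i < n ] 𝟙 (b (suc i)) ≡ 1 →
            ∃ λ p → b p ≡ true × ∀ i → b i ≡ true → i ≡ p
    split true b₀ 1+rest≡1 = zero , b₀ , only-zero
      where
        only-zero : ∀ i → b i ≡ true → i ≡ zero
        only-zero zero    _  = refl
        only-zero (suc i) bᵢ with () ← subst₂ _≤_ (cong 𝟙 bᵢ) (ℕ.suc-injective 1+rest≡1) (term≤∑ _ i)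
    split false b₀ rest≡1 with ∑-𝟙≡1 (b ∘ suc) rest≡1
    ... | p , bₚ , unique = suc p , bₚ , only-suc-p
      where
        only-suc-p : ∀ i → b i ≡ true → i ≡ suc p
        only-suc-p zero    b₀′ with () ← trans (sym b₀) b₀′
        only-suc-p (suc i) bᵢ  = cong suc (unique i bᵢ)

∑∑-distrib-+ : ∀ {m n} (f g : Fin m → Fin n → ℕ) →
               ∑[ i < m ] ∑[ j < n ] (f i j + g i j) ≡
               (∑[ i < m ] ∑[ j < n ] f i j) + (∑[ i < m ] ∑[ j < n ] g i j)
∑∑-distrib-+ {n = n} f g = trans (sum-cong-≗ λ i → ∑-distrib-+ (f i) (g i))
                                 (∑-distrib-+ (λ i → ∑[ j < n ] f i j) (λ i → ∑[ j < n ] g i j))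

module _ {n : ℕ} (G : Graph n) where

  isEdge : Fin n → Fin n → Bool
  isEdge i j = ⌊ i <? j ⌋ ∧ adj G i j

  edgeSum-∑ : ∀ w → edgeSum G w ≡ ∑[ i < n ] ∑[ j < n ] (𝟙 (isEdge i j) * w i j)
  edgeSum-∑ w = trans (∑-allFin (λ i → sum (map (summand i) (allFin n))))
                      (sum-cong-≗ λ i → trans (∑-allFin (summand i)) (sum-cong-≗ λ j → if-as-𝟙 (isEdge i j)))
    where
      summand : Fin n → Fin n → ℕ
      summand i j = if isEdge i j then w i j else 0
      if-as-𝟙 : ∀ b {x} → (if b then x else 0) ≡ 𝟙 b * x
      if-as-𝟙 true  = sym (+-identityʳ _)
      if-as-𝟙 false = refl

  degree-∑ : ∀ v → degree G v ≡ ∑[ j < n ] 𝟙 (adj G v j)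
  degree-∑ v = ∑-allFin (λ j → 𝟙 (adj G v j))

  edgeSum-cong : ∀ {w w′} → (∀ i j → Adj G i j → w i j ≡ w′ i j) → edgeSum G w ≡ edgeSum G w′
  edgeSum-cong {w} {w′} w≡w′ = begin
    edgeSum G w                                      ≡⟨ edgeSum-∑ w ⟩
    ∑[ i < n ] ∑[ j < n ] (𝟙 (isEdge i j) * w i j)    ≡⟨ sum-cong-≗ (λ i → sum-cong-≗ (on-edges i)) ⟩
    ∑[ i < n ] ∑[ j < n ] (𝟙 (isEdge i j) * w′ i j)   ≡⟨ edgeSum-∑ w′ ⟨
    edgeSum G w′                                     ∎
    where
      open ≡-Reasoning
      on-edges : ∀ i j → 𝟙 (⌊ i <? j ⌋ ∧ adj G i j) * w i j ≡ 𝟙 (⌊ i <? j ⌋ ∧ adj G i j) * w′ i j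
      on-edges i j with ⌊ i <? j ⌋ | adj G i j in ij
      ... | false | _     = refl
      ... | true  | false = refl
      ... | true  | true  = cong (1 *_) (w≡w′ i j ij)

  edgeSum-+ : ∀ w w′ → edgeSum G (λ i j → w i j + w′ i j) ≡ edgeSum G w + edgeSum G w′
  edgeSum-+ w w′ = begin
    edgeSum G (λ i j → w i j + w′ i j)
      ≡⟨ edgeSum-∑ _ ⟩
    ∑[ i < n ] ∑[ j < n ] (𝟙 (isEdge i j) * (w i j + w′ i j))
      ≡⟨ sum-cong-≗ (λ i → sum-cong-≗ λ j → *-distribˡ-+ (𝟙 (isEdge i j)) (w i j) (w′ i j)) ⟩
    ∑[ i < n ] ∑[ j < n ] (𝟙 (isEdge i j) * w i j + 𝟙 (isEdge i j) * w′ i j)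
      ≡⟨ ∑∑-distrib-+ (λ i j → 𝟙 (isEdge i j) * w i j) (λ i j → 𝟙 (isEdge i j) * w′ i j) ⟩
    (∑[ i < n ] ∑[ j < n ] (𝟙 (isEdge i j) * w i j)) + (∑[ i < n ] ∑[ j < n ] (𝟙 (isEdge i j) * w′ i j))
      ≡⟨ cong₂ _+_ (edgeSum-∑ w) (edgeSum-∑ w′) ⟨
    edgeSum G w + edgeSum G w′
      ∎
    where open ≡-Reasoning

  edgeSum-const : ∀ k → edgeSum G (λ _ _ → k) ≡ k * edgeCount G
  edgeSum-const k = begin
    edgeSum G (λ _ _ → k)
      ≡⟨ edgeSum-∑ _ ⟩
    ∑[ i < n ] ∑[ j < n ] (𝟙 (isEdge i j) * k)
      ≡⟨ sum-cong-≗ (λ i → sum-cong-≗ λ j → pull-k (𝟙 (isEdge i j))) ⟩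
    ∑[ i < n ] ∑[ j < n ] (k * (𝟙 (isEdge i j) * 1))
      ≡⟨ sum-cong-≗ (λ i → *-distribˡ-sum k (λ j → 𝟙 (isEdge i j) * 1)) ⟨
    ∑[ i < n ] (k * ∑[ j < n ] (𝟙 (isEdge i j) * 1))
      ≡⟨ *-distribˡ-sum k (λ i → ∑[ j < n ] (𝟙 (isEdge i j) * 1)) ⟨
    k * ∑[ i < n ] ∑[ j < n ] (𝟙 (isEdge i j) * 1)
      ≡⟨ cong (k *_) (edgeSum-∑ _) ⟨
    k * edgeCount G
      ∎
    where
      open ≡-Reasoning
      pull-k : ∀ e → e * k ≡ k * (e * 1)
      pull-k e = trans (*-comm e k) (cong (k *_) (sym (*-identityʳ e)))

  edge-orientations : ∀ i j → 𝟙 (isEdge i j) + 𝟙 (isEdge j i) ≡ 𝟙 (adj G i j)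
  edge-orientations i j with i <? j | j <? i
  ... | yes i<j | yes j<i = contradiction j<i (<-asym i<j)
  ... | yes _   | no _    = +-identityʳ _
  ... | no _    | yes _   = cong 𝟙 (Graph.sym G j i)
  ... | no i≮j  | no j≮i with toℕ-injective (≤-antisym (≮⇒≥ j≮i) (≮⇒≥ i≮j))
  ...   | refl = cong 𝟙 (sym (loopless G i))

  handshake : ∀ (f : Fin n → ℕ) → edgeSum G (λ i j → f i + f j) ≡ ∑[ i < n ] (degree G i * f i)
  handshake f = begin
    edgeSum G (λ i j → f i + f j)
      ≡⟨ edgeSum-+ (λ i _ → f i) (λ _ j → f j) ⟩
    edgeSum G (λ i _ → f i) + edgeSum G (λ _ j → f j)
      ≡⟨ cong₂ _+_ (edgeSum-∑ _) (trans (edgeSum-∑ _) (∑-comm (λ i j → 𝟙 (isEdge i j) * f j))) ⟩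
    (∑[ i < n ] ∑[ j < n ] (𝟙 (isEdge i j) * f i)) + (∑[ i < n ] ∑[ j < n ] (𝟙 (isEdge j i) * f i))
      ≡⟨ ∑∑-distrib-+ (λ i j → 𝟙 (isEdge i j) * f i) (λ i j → 𝟙 (isEdge j i) * f i) ⟨
    ∑[ i < n ] ∑[ j < n ] (𝟙 (isEdge i j) * f i + 𝟙 (isEdge j i) * f i)
      ≡⟨ sum-cong-≗ (λ i → sum-cong-≗ λ j →
           trans (sym (*-distribʳ-+ (f i) (𝟙 (isEdge i j)) _)) (cong (_* f i) (edge-orientations i j))) ⟩
    ∑[ i < n ] ∑[ j < n ] (𝟙 (adj G i j) * f i)
      ≡⟨ sum-cong-≗ (λ i → trans (sym (*-distribʳ-sum (f i) (λ j → 𝟙 (adj G i j)))) (cong (_* f i) (sym (degree-∑ i)))) ⟩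
    ∑[ i < n ] (degree G i * f i)
      ∎
    where open ≡-Reasoning

Distinct : ∀ {A : Set} → List A → Set
Distinct = AllPairs _≢_

lookup-injective : ∀ {A : Set} {xs : List A} → Distinct xs → Injective _≡_ _≡_ (lookup xs)
lookup-injective (x∉xs ∷ _) {zero}  {zero}  _ = refl
lookup-injective (x∉xs ∷ _) {zero}  {suc j} x≡xⱼ = contradiction x≡xⱼ (All.lookup x∉xs (∈-lookup j))
lookup-injective (x∉xs ∷ _) {suc i} {zero}  xᵢ≡x = contradiction (sym xᵢ≡x) (All.lookup x∉xs (∈-lookup i))
lookup-injective (_ ∷ xs!)  {suc i} {suc j} xᵢ≡xⱼ = cong suc (lookup-injective xs! xᵢ≡xⱼ)

Distinct⇒length≤ : ∀ {n} {xs : List (Fin n)} → Distinct xs → length xs ≤ n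
Distinct⇒length≤ xs! = injective⇒≤ (lookup-injective xs!)

_without_ : ∀ {n} → (Fin n → Fin n → ℕ) → Fin n → Fin n → Fin n → ℕ
(w without p) i j = if ⌊ i ≟ p ⌋ ∨ ⌊ j ≟ p ⌋ then 0 else w i j

module _ {n : ℕ} (w : Fin n → Fin n → ℕ) (p : Fin n) where

  without-off : ∀ {i j} → i ≢ p → j ≢ p → (w without p) i j ≡ w i j
  without-off {i} {j} i≢p j≢p with i ≟ p | j ≟ p
  ... | yes i≡p | _       = contradiction i≡p i≢p
  ... | no _    | yes j≡p = contradiction j≡p j≢p
  ... | no _    | no _    = refl

  without-at : ∀ j → (w without p) p j ≡ 0
  without-at j with p ≟ p
  ... | yes _   = refl
  ... | no p≢p = contradiction refl p≢p

  without-sym : (∀ i j → w i j ≡ w j i) → ∀ i j → (w without p) i j ≡ (w without p) j i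
  without-sym w-sym i j with i ≟ p | j ≟ p
  ... | yes _ | yes _ = refl
  ... | yes _ | no _  = refl
  ... | no _  | yes _ = refl
  ... | no _  | no _  = w-sym i j

  without-cong : ∀ {w′ i j} → (i ≢ p → j ≢ p → w i j ≡ w′ i j) → (w without p) i j ≡ (w′ without p) i j
  without-cong {i = i} {j} w≡w′ with i ≟ p | j ≟ p
  ... | yes _  | _      = refl
  ... | no _   | yes _  = refl
  ... | no i≢p | no j≢p = w≡w′ i≢p j≢p

record PendantPair {n : ℕ} (G : Graph n) : Set where
  field
    u v u′ v′ : Fin n
    degree-u : degree G u ≡ 1
    degree-v : degree G v ≡ 1
    neighbour-u : ∀ j → Adj G u j → j ≡ u′
    neighbour-v : ∀ j → Adj G v j → j ≡ v′
    distinct : Distinct (u ∷ v ∷ u′ ∷ v′ ∷ [])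

module _ {n : ℕ} (G : Graph n) where

  Adj-sym : ∀ {i j} → Adj G i j → Adj G j i
  Adj-sym {i} {j} ij = trans (Graph.sym G j i) ij

  Adj⇒≢ : ∀ {i j} → Adj G i j → i ≢ j
  Adj⇒≢ {i} ii refl with () ← trans (sym ii) (loopless G i)

  unique-neighbour : ∀ {u} → degree G u ≡ 1 → ∃ λ u′ → Adj G u u′ × ∀ j → Adj G u j → j ≡ u′
  unique-neighbour {u} deg≡1 = ∑-𝟙≡1 (adj G u) (trans (sym (degree-∑ G u)) deg≡1)

  twoGood⇒pendantPair : TwoGood G → PendantPair G
  twoGood⇒pendantPair (u , v , deg-u , deg-v , u≢v , ¬uv , ¬common)
    with unique-neighbour deg-u | unique-neighbour deg-v
  ... | u′ , uu′ , only-u′ | v′ , vv′ , only-v′ = record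
    { u = u ; v = v ; u′ = u′ ; v′ = v′
    ; degree-u = deg-u ; degree-v = deg-v
    ; neighbour-u = only-u′ ; neighbour-v = only-v′
    ; distinct = (u≢v ∷ Adj⇒≢ uu′ ∷ u≢v′ ∷ []) ∷ (v≢u′ ∷ Adj⇒≢ vv′ ∷ []) ∷ (u′≢v′ ∷ []) ∷ [] ∷ []
    }
    where
      u≢v′ : u ≢ v′
      u≢v′ refl = ¬uv (Adj-sym vv′)
      v≢u′ : v ≢ u′
      v≢u′ refl = ¬uv uu′
      u′≢v′ : u′ ≢ v′
      u′≢v′ refl = ¬common (u′ , uu′ , Adj-sym vv′)

  pendant-split : ∀ {u u′} (w : Fin n → Fin n → ℕ) → (∀ i j → w i j ≡ w j i) →
                  degree G u ≡ 1 → (∀ j → Adj G u j → j ≡ u′) →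
                  edgeSum G w ≡ edgeSum G (w without u) + w u u′
  pendant-split {u} {u′} w w-sym deg≡1 only-u′ = begin
    edgeSum G w                                    ≡⟨ edgeSum-cong G on-edges ⟩
    edgeSum G (λ i j → (w without u) i j + (f i + f j))
                                                   ≡⟨ edgeSum-+ G (w without u) _ ⟩
    R + edgeSum G (λ i j → f i + f j)              ≡⟨ cong (R +_) (handshake G f) ⟩
    R + ∑[ i < n ] (degree G i * f i)              ≡⟨ cong (R +_) (∑-single (λ i → degree G i * f i) u λ _ → vanishes-off) ⟩
    R + degree G u * f u                           ≡⟨ cong (λ d → R + d * f u) deg≡1 ⟩
    R + 1 * f u                                    ≡⟨ cong (R +_) (trans (*-identityˡ (f u)) f-at) ⟩
    edgeSum G (w without u) + w u u′               ∎
    where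
      open ≡-Reasoning
      R : ℕ
      R = edgeSum G (w without u)
      f : Fin n → ℕ
      f i = if ⌊ i ≟ u ⌋ then w u u′ else 0
      f-at : f u ≡ w u u′
      f-at with u ≟ u
      ... | yes _   = refl
      ... | no u≢u = contradiction refl u≢u
      f-off : ∀ {i} → i ≢ u → f i ≡ 0
      f-off {i} i≢u with i ≟ u
      ... | yes i≡u = contradiction i≡u i≢u
      ... | no _    = refl
      vanishes-off : ∀ {i} → i ≢ u → degree G i * f i ≡ 0
      vanishes-off {i} i≢u = trans (cong (degree G i *_) (f-off i≢u)) (*-zeroʳ (degree G i))
      on-edges : ∀ i j → Adj G i j → w i j ≡ (w without u) i j + (f i + f j)
      on-edges i j ij = cases (i ≟ u) (j ≟ u)
        where
          cases : Dec (i ≡ u) → Dec (j ≡ u) → w i j ≡ (w without u) i j + (f i + f j)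
          cases (yes refl) _ with refl ← only-u′ j ij = sym (begin
            (w without u) u u′ + (f u + f u′)
              ≡⟨ cong₂ _+_ (without-at w u u′) (cong₂ _+_ f-at (f-off (≢-sym (Adj⇒≢ ij)))) ⟩
            w u u′ + 0
              ≡⟨ +-identityʳ _ ⟩
            w u u′
              ∎)
          cases (no i≢u) (yes refl) with refl ← only-u′ i (Adj-sym ij) = begin
            w u′ u
              ≡⟨ w-sym u′ u ⟩
            w u u′
              ≡⟨ cong₂ _+_ (trans (without-sym w u w-sym u′ u) (without-at w u u′)) (cong₂ _+_ (f-off i≢u) f-at) ⟨
            (w without u) u′ u + (f u′ + f u)
              ∎
          cases (no i≢u) (no j≢u) = sym (begin
            (w without u) i j + (f i + f j)
              ≡⟨ cong₂ _+_ (without-off w u i≢u j≢u) (cong₂ _+_ (f-off i≢u) (f-off j≢u)) ⟩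
            w i j + 0
              ≡⟨ +-identityʳ _ ⟩
            w i j
              ∎)

  pendants-split : (P : PendantPair G) → let open PendantPair P in
                   ∀ (w : Fin n → Fin n → ℕ) → (∀ i j → w i j ≡ w j i) →
                   edgeSum G w ≡ edgeSum G ((w without v) without u) + w u u′ + w v v′
  pendants-split P w w-sym = begin
    edgeSum G w
      ≡⟨ pendant-split w w-sym degree-v neighbour-v ⟩
    edgeSum G (w without v) + w v v′
      ≡⟨ cong (_+ w v v′) (pendant-split (w without v) (without-sym w v w-sym) degree-u neighbour-u) ⟩
    edgeSum G ((w without v) without u) + (w without v) u u′ + w v v′
      ≡⟨ cong (λ x → edgeSum G ((w without v) without u) + x + w v v′) (without-off w v u≢v u′≢v) ⟩
    edgeSum G ((w without v) without u) + w u u′ + w v v′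
      ∎
    where
      open ≡-Reasoning
      open PendantPair P
      u≢v : u ≢ v
      u≢v with (u≢v ∷ _) ∷ _ ← distinct = u≢v
      u′≢v : u′ ≢ v
      u′≢v with _ ∷ (v≢u′ ∷ _) ∷ _ ← distinct = ≢-sym v≢u′

-- In ℤ₃ the sumset {α₁, α₂} + {β₁, β₂} has at least three elements (Cauchy–Davenport), so it
-- meets every residue class; the finitely many cases are checked by evaluation.
opaque
  ℤ₃-pair-sums : ∀ (s a₁ a₂ b₁ b₂ : Fin 3) → a₁ ≢ a₂ → b₁ ≢ b₂ →
                 ∃₂ λ (i j : Fin 2) → (toℕ s + (toℕ ((a₁ V.∷ a₂ V.∷ V.[]) i) + toℕ ((b₁ V.∷ b₂ V.∷ V.[]) j))) % 3 ≡ 0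
  ℤ₃-pair-sums = toWitness {a? = all? λ s → all? λ a₁ → all? λ a₂ → all? λ b₁ → all? λ b₂ →
    ¬? (a₁ ≟ a₂) →-dec ¬? (b₁ ≟ b₂) →-dec any? λ i → any? λ j →
    (toℕ s + (toℕ ((a₁ V.∷ a₂ V.∷ V.[]) i) + toℕ ((b₁ V.∷ b₂ V.∷ V.[]) j))) % 3 ℕ.≟ 0} _

ℤ₃-choice : ∀ (s : ℕ) (α β : Fin 2 → Fin 3) → α zero ≢ α (suc zero) → β zero ≢ β (suc zero) →
            ∃₂ λ i j → (s + (toℕ (α i) + toℕ (β j))) % 3 ≡ 0
ℤ₃-choice s α β α₀≢α₁ β₀≢β₁ with ℤ₃-pair-sums (s mod 3) _ _ _ _ α₀≢α₁ β₀≢β₁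
... | i , j , ≡0 = i , j , (begin
  (s + t) % 3                ≡⟨ %-distribˡ-+ s t 3 ⟩
  (s % 3 + t % 3) % 3        ≡⟨ cong (λ r → (r + t % 3) % 3) (m%n%n≡m%n s 3) ⟨
  (s % 3 % 3 + t % 3) % 3    ≡⟨ %-distribˡ-+ (s % 3) t 3 ⟨
  (s % 3 + t) % 3            ≡⟨ cong₂ (λ r t → (r + t) % 3) (sym (toℕ-fromℕ< (m%n<n s 3)))
                                                           (cong₂ _+_ (pair-η α i) (pair-η β j)) ⟩
  _                          ≡⟨ ≡0 ⟩
  0                          ∎)
  where
    open ≡-Reasoning
    t : ℕ
    t = toℕ (α i) + toℕ (β j)
    pair-η : (γ : Fin 2 → Fin 3) → ∀ k → toℕ (γ k) ≡ toℕ ((γ zero V.∷ γ (suc zero) V.∷ V.[]) k)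
    pair-η γ zero       = refl
    pair-η γ (suc zero) = refl

module _ {N : ℕ} where
  open import Data.List.Membership.DecPropositional (_≟_ {N}) using (_∈?_)

  fresh : ∀ (xs : List (Fin N)) → length xs < N → ∃ λ y → All (y ≢_) xs
  fresh xs |xs|<N with any? (λ y → ¬? (y ∈? xs))
  ... | yes (y , y∉xs) = y , ¬Any⇒All¬ xs y∉xs
  ... | no ∄y = contradiction (injective⇒≤ position-injective) (<⇒≱ |xs|<N)
    where
      ∈xs : ∀ y → y ∈ xs
      ∈xs y = decidable-stable (y ∈? xs) (λ y∉xs → ∄y (y , y∉xs))
      position-injective : Injective _≡_ _≡_ (λ y → Any.index (∈xs y))
      position-injective {y} {y′} eq = begin
        y                              ≡⟨ lookup-index (∈xs y) ⟩
        lookup xs (Any.index (∈xs y))   ≡⟨ cong (lookup xs) eq ⟩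
        lookup xs (Any.index (∈xs y′))  ≡⟨ lookup-index (∈xs y′) ⟨
        y′                             ∎
        where open ≡-Reasoning

  transpose-injective : ∀ (i j : Fin N) → Injective _≡_ _≡_ (transpose i j)
  transpose-injective i j {x} {y} eq = begin
    x                                  ≡⟨ transpose-inverse j i ⟨
    transpose j i (transpose i j x)    ≡⟨ cong (transpose j i) eq ⟩
    transpose j i (transpose i j y)    ≡⟨ transpose-inverse j i ⟩
    y                                  ∎
    where open ≡-Reasoning

  transpose-at : ∀ (i j : Fin N) → transpose i j i ≡ j
  transpose-at i j rewrite dec-true (i ≟ i) refl = refl

  transpose-off : ∀ {i j k : Fin N} → k ≢ i → k ≢ j → transpose i j k ≡ k
  transpose-off {i} {j} {k} k≢i k≢j rewrite dec-false (k ≟ i) k≢i | dec-false (k ≟ j) k≢j = refl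

  permutation-mapping : ∀ (ss ts : List (Fin N)) → length ss ≡ length ts → Distinct ss → Distinct ts →
                        ∃ λ (π : Fin N → Fin N) → Injective _≡_ _≡_ π × Pointwise (λ s t → π s ≡ t) ss ts
  permutation-mapping []       []       _ _ _ = id , id , []
  permutation-mapping (s ∷ ss) (t ∷ ts) |ss|≡|ts| (s∉ss ∷ ss!) (t∉ts ∷ ts!)
    with permutation-mapping ss ts (ℕ.suc-injective |ss|≡|ts|) ss! ts!
  ... | π , π-injective , π[ss]≡ts =
    transpose (π s) t ∘ π ,
    π-injective ∘ transpose-injective (π s) t ,
    transpose-at (π s) t ∷ fixed s∉ss t∉ts π[ss]≡ts
    where
      fixed : ∀ {ss′ ts′} → All (s ≢_) ss′ → All (t ≢_) ts′ → Pointwise (λ s t → π s ≡ t) ss′ ts′ →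
              Pointwise (λ s′ t′ → transpose (π s) t (π s′) ≡ t′) ss′ ts′
      fixed []              []              []           = []
      fixed (s≢s′ ∷ s∉ss′) (t≢t′ ∷ t∉ts′) (refl ∷ eqs) =
        transpose-off (λ eq → s≢s′ (sym (π-injective eq))) (≢-sym t≢t′) ∷ fixed s∉ss′ t∉ts′ eqs

module _ {n N : ℕ} (n+2≤N : n + 2 ≤ N) where

  private
    1+n<N : suc n < N
    1+n<N = subst (_≤ N) (+-comm n 2) n+2≤N
    n<N : n < N
    n<N = <⇒≤ 1+n<N
    ι : Fin n → Fin N
    ι w = inject≤ w (<⇒≤ n<N)
    ι-injective : Injective _≡_ _≡_ ι
    ι-injective = inject≤-injective _ _ _ _
    top₁ top₂ : Fin N
    top₁ = fromℕ< n<N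
    top₂ = fromℕ< 1+n<N
    ι≢top : ∀ {m} (m<N : m < N) → n ≤ m → ∀ w → ι w ≢ fromℕ< m<N
    ι≢top m<N n≤m w eq = <⇒≢ (≤-trans (toℕ<n w) n≤m) (begin
      toℕ w                ≡⟨ toℕ-inject≤ w _ ⟨
      toℕ (ι w)            ≡⟨ cong toℕ eq ⟩
      toℕ (fromℕ< m<N)     ≡⟨ toℕ-fromℕ< m<N ⟩
      _                    ∎)
      where open ≡-Reasoning
    top₁≢top₂ : top₁ ≢ top₂
    top₁≢top₂ eq = <⇒≢ (n<1+n n) (trans (sym (toℕ-fromℕ< n<N)) (trans (cong toℕ eq) (toℕ-fromℕ< 1+n<N)))

    sources-distinct : ∀ {ps} → Distinct ps → Distinct (top₁ ∷ top₂ ∷ map ι ps)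
    sources-distinct {ps} ps! =
      (top₁≢top₂ ∷ All.map⁺ (All.universal (λ w → ≢-sym (ι≢top n<N ≤-refl w)) ps))
      ∷ All.map⁺ (All.universal (λ w → ≢-sym (ι≢top 1+n<N (n≤1+n n) w)) ps)
      ∷ AllPairs.map⁺ (AllPairs.map (λ p≢q → p≢q ∘ ι-injective) ps!)

  embedding-avoiding : ∀ (ps : List (Fin n)) (qs : List (Fin N)) {z₁ z₂ : Fin N} →
                       length ps ≡ length qs → Distinct ps → Distinct (z₁ ∷ z₂ ∷ qs) →
                       ∃ λ (φ : Fin n → Fin N) → Injective _≡_ _≡_ φ × Pointwise (λ p q → φ p ≡ q) ps qs ×
                                                (∀ w → φ w ≢ z₁) × (∀ w → φ w ≢ z₂)
  embedding-avoiding ps qs |ps|≡|qs| ps! targets!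
    with permutation-mapping (top₁ ∷ top₂ ∷ map ι ps) _ (cong (2 +_) (trans (length-map ι ps) |ps|≡|qs|))
                             (sources-distinct ps!) targets!
  ... | π , π-injective , (π[top₁]≡z₁ ∷ π[top₂]≡z₂ ∷ π[ι[ps]]≡qs) =
    π ∘ ι , ι-injective ∘ π-injective , pull ps π[ι[ps]]≡qs ,
    (λ w eq → ι≢top n<N ≤-refl w (π-injective (trans eq (sym π[top₁]≡z₁)))) ,
    (λ w eq → ι≢top 1+n<N (n≤1+n n) w (π-injective (trans eq (sym π[top₂]≡z₂))))
    where
      pull : ∀ ps′ {qs′} → Pointwise (λ x q → π x ≡ q) (map ι ps′) qs′ → Pointwise (λ p q → π (ι p) ≡ q) ps′ qs′
      pull []        []           = []
      pull (_ ∷ ps′) (eq ∷ eqs) = eq ∷ pull ps′ eqs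

module Cherries {A : Set} (_≟ᴬ_ : DecidableEquality A) {N : ℕ}
                (c : Fin N → Fin N → A) (c-sym : ∀ i j → c i j ≡ c j i) where

  record Cherry : Set where
    constructor cherry
    field
      centre leaf₁ leaf₂ : Fin N
      centre≢leaf₁ : centre ≢ leaf₁
      centre≢leaf₂ : centre ≢ leaf₂
      bichromatic : c centre leaf₁ ≢ c centre leaf₂

    leaf₁≢leaf₂ : leaf₁ ≢ leaf₂
    leaf₁≢leaf₂ eq = bichromatic (cong (c centre) eq)

  vertices : Cherry → List (Fin N)
  vertices C = centre ∷ leaf₁ ∷ leaf₂ ∷ [] where open Cherry C

  Outside : Cherry → Fin N → Set
  Outside C z = All (z ≢_) (vertices C)

  outside? : ∀ C → Decidable (Outside C)
  outside? C z = All.all? (λ v → ¬? (z ≟ v)) (vertices C)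

  flip : Cherry → Cherry
  flip (cherry a x x′ a≢x a≢x′ bi) = cherry a x′ x a≢x′ a≢x (bi ∘ sym)

  -- flip is definitionally involutive, so this also converts Outside (flip C) back to Outside C.
  outside-flip : ∀ {C z} → Outside C z → Outside (flip C) z
  outside-flip (z≢a ∷ z≢x ∷ z≢x′ ∷ []) = z≢a ∷ z≢x′ ∷ z≢x ∷ []

  TwoDisjointCherries : Set
  TwoDisjointCherries = Σ[ C₁ ∈ Cherry ] Σ[ C₂ ∈ Cherry ] All (Outside C₁) (vertices C₂)

  AlmostMonochromatic : Set
  AlmostMonochromatic = ∃₂ λ z₁ z₂ → z₁ ≢ z₂ × ∃ λ k →
    ∀ {i j} → i ≢ j → i ≢ z₁ → i ≢ z₂ → j ≢ z₁ → j ≢ z₂ → c i j ≡ k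

  cherry-or-monochromatic : ∀ {P : Pred (Fin N) 0ℓ} → Decidable P → ∀ {w₁ w₂} → P w₁ → P w₂ → w₁ ≢ w₂ →
                            (Σ[ C ∈ Cherry ] All P (vertices C)) ⊎ (∀ {i j} → P i → P j → i ≢ j → c i j ≡ c w₁ w₂)
  cherry-or-monochromatic {P} P? {w₁} {w₂} P[w₁] P[w₂] w₁≢w₂
    with any? (λ x → any? λ y₁ → any? λ y₂ →
           P? x ×-dec P? y₁ ×-dec P? y₂ ×-dec ¬? (x ≟ y₁) ×-dec ¬? (x ≟ y₂) ×-dec ¬? (c x y₁ ≟ᴬ c x y₂))
  ... | yes (x , y₁ , y₂ , P[x] , P[y₁] , P[y₂] , x≢y₁ , x≢y₂ , bi) =
    inj₁ (cherry x y₁ y₂ x≢y₁ x≢y₂ bi , P[x] ∷ P[y₁] ∷ P[y₂] ∷ [])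
  ... | no ∄cherry = inj₂ monochromatic
    where
      star : ∀ {x y₁ y₂} → P x → P y₁ → P y₂ → x ≢ y₁ → x ≢ y₂ → c x y₁ ≡ c x y₂
      star {x} {y₁} {y₂} P[x] P[y₁] P[y₂] x≢y₁ x≢y₂ = decidable-stable (c x y₁ ≟ᴬ c x y₂)
        λ bi → ∄cherry (x , y₁ , y₂ , P[x] , P[y₁] , P[y₂] , x≢y₁ , x≢y₂ , bi)
      monochromatic : ∀ {i j} → P i → P j → i ≢ j → c i j ≡ c w₁ w₂
      monochromatic {i} {j} P[i] P[j] i≢j with i ≟ w₁
      ... | yes refl = star P[i] P[j] P[w₂] i≢j w₁≢w₂
      ... | no i≢w₁  = begin
        c i j    ≡⟨ star P[i] P[j] P[w₁] i≢j i≢w₁ ⟩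
        c i w₁   ≡⟨ c-sym i w₁ ⟩
        c w₁ i   ≡⟨ star P[w₁] P[i] P[w₂] (≢-sym i≢w₁) w₁≢w₂ ⟩
        c w₁ w₂  ∎
        where open ≡-Reasoning

  module _ (6≤N : 6 ≤ N) where

    private
      pick : (xs : List (Fin N)) → {True (length xs ℕ.≤? 5)} → ∃ λ y → All (y ≢_) xs
      pick xs {|xs|≤5} = fresh xs (≤-trans (s≤s (toWitness |xs|≤5)) 6≤N)

    module Oriented (C : Cherry) (k : A) (mono : ∀ {i j} → Outside C i → Outside C j → i ≢ j → c i j ≡ k) where
      open Cherry C renaming (centre to a; leaf₁ to x; leaf₂ to x′)

      almostMonochromatic : (∀ w → Outside C w → c x w ≡ k) → AlmostMonochromatic
      almostMonochromatic uniform = a , x′ , centre≢leaf₂ , k , edge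
        where
          leaf-or-outside : ∀ {i} → i ≢ a → i ≢ x′ → i ≡ x ⊎ Outside C i
          leaf-or-outside {i} i≢a i≢x′ with i ≟ x
          ... | yes i≡x = inj₁ i≡x
          ... | no i≢x  = inj₂ (i≢a ∷ i≢x ∷ i≢x′ ∷ [])
          edge : ∀ {i j} → i ≢ j → i ≢ a → i ≢ x′ → j ≢ a → j ≢ x′ → c i j ≡ k
          edge i≢j i≢a i≢x′ j≢a j≢x′ with leaf-or-outside i≢a i≢x′ | leaf-or-outside j≢a j≢x′
          ... | inj₁ refl  | inj₁ refl  = contradiction refl i≢j
          ... | inj₁ refl  | inj₂ out-j = uniform _ out-j
          ... | inj₂ out-i | inj₁ refl  = trans (c-sym _ _) (uniform _ out-i)
          ... | inj₂ out-i | inj₂ out-j = mono out-i out-j i≢j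

      twoCherries : ∀ {o u} → Outside C o → c a x ≢ c a o → Outside C u → u ≢ o → c x′ u ≢ k → TwoDisjointCherries
      twoCherries {o} {u} (o≢a ∷ o≢x ∷ o≢x′ ∷ []) ax≢ao out-u@(u≢a ∷ u≢x ∷ u≢x′ ∷ []) u≢o x′u≢k
        with pick (a ∷ x ∷ x′ ∷ u ∷ o ∷ [])
      ... | w , w≢a ∷ w≢x ∷ w≢x′ ∷ w≢u ∷ w≢o ∷ [] =
        cherry a x o centre≢leaf₁ (≢-sym o≢a) ax≢ao ,
        cherry u x′ w u≢x′ (≢-sym w≢u) ux′≢uw ,
        (u≢a ∷ u≢x ∷ u≢o ∷ []) ∷
        (≢-sym centre≢leaf₂ ∷ ≢-sym leaf₁≢leaf₂ ∷ ≢-sym o≢x′ ∷ []) ∷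
        (w≢a ∷ w≢x ∷ w≢o ∷ []) ∷ []
        where
          ux′≢uw : c u x′ ≢ c u w
          ux′≢uw eq = x′u≢k (trans (c-sym x′ u) (trans eq (mono out-u (w≢a ∷ w≢x ∷ w≢x′ ∷ []) (≢-sym w≢u))))

    -- If a leaf of C sends only colour k outside, every edge off {a, other leaf} has colour k.
    -- Otherwise take outside u₁, u₂ with c x u₁ ≢ k, c x′ u₂ ≢ k and a further outside o: since
    -- c a x ≢ c a x′, one of (a; x, o), (a; x′, o) is a cherry, disjoint from (u₂; x′, w) resp. (u₁; x, w).
    module AfterFirstCherry (C : Cherry) (k : A) (mono : ∀ {i j} → Outside C i → Outside C j → i ≢ j → c i j ≡ k) where
      open Cherry C renaming (centre to a; leaf₁ to x; leaf₂ to x′)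
      private
        module O = Oriented C k mono
        module O′ = Oriented (flip C) k (λ out-i out-j → mono (outside-flip {flip C} out-i) (outside-flip {flip C} out-j))
        uniform : ∀ {y} → ¬ ∃ (λ u → Outside C u × c y u ≢ k) → ∀ w → Outside C w → c y w ≡ k
        uniform {y} ∄bad w out = decidable-stable (c y w ≟ᴬ k) (λ bad → ∄bad (w , out , bad))

      result : TwoDisjointCherries ⊎ AlmostMonochromatic
      result with any? (λ u → outside? C u ×-dec ¬? (c x u ≟ᴬ k)) | any? (λ u → outside? C u ×-dec ¬? (c x′ u ≟ᴬ k))
      ... | no ∄bad | _        = inj₂ (O.almostMonochromatic (uniform ∄bad))
      ... | yes _   | no ∄bad′ = inj₂ (O′.almostMonochromatic (λ w → uniform ∄bad′ w ∘ outside-flip {flip C}))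
      ... | yes (u₁ , out₁ , bad₁) | yes (u₂ , out₂ , bad₂) with pick (a ∷ x ∷ x′ ∷ u₁ ∷ u₂ ∷ [])
      ...   | o , o≢a ∷ o≢x ∷ o≢x′ ∷ o≢u₁ ∷ o≢u₂ ∷ [] with c a x ≟ᴬ c a o
      ...     | no ax≢ao  = inj₁ (O.twoCherries (o≢a ∷ o≢x ∷ o≢x′ ∷ []) ax≢ao out₂ (≢-sym o≢u₂) bad₂)
      ...     | yes ax≡ao = inj₁ (O′.twoCherries (o≢a ∷ o≢x′ ∷ o≢x ∷ []) (λ ax′≡ao → bichromatic (trans ax≡ao (sym ax′≡ao)))
                                                 (outside-flip {C} out₁) (≢-sym o≢u₁) bad₁)

    cherries-or-almostMonochromatic : TwoDisjointCherries ⊎ AlmostMonochromatic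
    cherries-or-almostMonochromatic with pick []
    ... | v₀ , [] with pick (v₀ ∷ [])
    ... | v₁ , v₁≢v₀ ∷ [] with cherry-or-monochromatic {P = U} (λ _ → yes tt) tt tt (≢-sym v₁≢v₀)
    ... | inj₂ mono = inj₂ (v₀ , v₁ , ≢-sym v₁≢v₀ , c v₀ v₁ , λ i≢j _ _ _ _ → mono tt tt i≢j)
    ... | inj₁ (C , _) with pick (vertices C)
    ... | w₁ , out₁ with pick (w₁ ∷ vertices C)
    ... | w₂ , w₂≢w₁ ∷ out₂ with cherry-or-monochromatic (outside? C) out₁ out₂ (≢-sym w₂≢w₁)
    ... | inj₁ (C₂ , C₂-outside) = inj₁ (C , C₂ , C₂-outside)
    ... | inj₂ mono = AfterFirstCherry.result C (c w₁ w₂) mono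

updateAt-injective : ∀ {A : Set} {n} {f : Fin n → A} {p : Fin n} {t : A} → Injective _≡_ _≡_ f →
                     (∀ w → f w ≡ t → w ≡ p) → Injective _≡_ _≡_ (updateAt f p (const t))
updateAt-injective {f = f} {p} {t} f-injective only-p {w} {w′} = cases (w ≟ p) (w′ ≟ p)
  where
    at-p : updateAt f p (const t) p ≡ t
    at-p = updateAt-updates p f
    off-p : ∀ {x} → x ≢ p → updateAt f p (const t) x ≡ f x
    off-p {x} x≢p = updateAt-minimal x p f x≢p
    cases : Dec (w ≡ p) → Dec (w′ ≡ p) → updateAt f p (const t) w ≡ updateAt f p (const t) w′ → w ≡ w′
    cases (yes refl) (yes refl) _  = refl
    cases (yes refl) (no w′≢p)  eq = sym (only-p w′ (trans (sym (off-p w′≢p)) (trans (sym eq) at-p)))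
    cases (no w≢p)   (yes refl) eq = only-p w (trans (sym (off-p w≢p)) (trans eq at-p))
    cases (no w≢p)   (no w′≢p)  eq = f-injective (trans (sym (off-p w≢p)) (trans eq (off-p w′≢p)))

module UpperBound {n : ℕ} (G : Graph n) (P : PendantPair G) {N : ℕ} (n+2≤N : n + 2 ≤ N)
                  (c : Fin N → Fin N → Fin 3) (c-sym : ∀ i j → c i j ≡ c j i) where
  open Cherries _≟_ c c-sym
  open PendantPair P

  weight : (Fin n → Fin N) → Fin n → Fin n → ℕ
  weight φ i j = toℕ (c (φ i) (φ j))

  weight-sym : ∀ φ i j → weight φ i j ≡ weight φ j i
  weight-sym φ i j = cong toℕ (c-sym (φ i) (φ j))

  copy-from-almostMonochromatic : edgeCount G % 3 ≡ 0 → AlmostMonochromatic → ZeroSumCopy G N c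
  copy-from-almostMonochromatic e≡0 (z₁ , z₂ , z₁≢z₂ , k , mono)
    with embedding-avoiding n+2≤N [] [] refl [] ((z₁≢z₂ ∷ []) ∷ [] ∷ [])
  ... | φ , φ-injective , [] , φ≢z₁ , φ≢z₂ = φ , φ-injective , (begin
    edgeSum G (weight φ) % 3             ≡⟨ cong (_% 3) (edgeSum-cong G on-edges) ⟩
    edgeSum G (λ _ _ → toℕ k) % 3        ≡⟨ cong (_% 3) (edgeSum-const G (toℕ k)) ⟩
    (toℕ k * edgeCount G) % 3            ≡⟨ %-distribˡ-* (toℕ k) (edgeCount G) 3 ⟩
    (toℕ k % 3 * (edgeCount G % 3)) % 3  ≡⟨ cong (λ e → (toℕ k % 3 * e) % 3) e≡0 ⟩
    (toℕ k % 3 * 0) % 3                  ≡⟨ cong (_% 3) (*-zeroʳ (toℕ k % 3)) ⟩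
    0                                    ∎)
    where
      open ≡-Reasoning
      on-edges : ∀ i j → Adj G i j → weight φ i j ≡ toℕ k
      on-edges i j ij = cong toℕ (mono (Adj⇒≢ G ij ∘ φ-injective) (φ≢z₁ i) (φ≢z₂ i) (φ≢z₁ j) (φ≢z₂ j))

  module Swapping {a x₁ x₂ b y₁ y₂ : Fin N} (ψ : Fin n → Fin N) (ψ-injective : Injective _≡_ _≡_ ψ)
                  (ψu≡x₁ : ψ u ≡ x₁) (ψv≡y₁ : ψ v ≡ y₁) (ψu′≡a : ψ u′ ≡ a) (ψv′≡b : ψ v′ ≡ b)
                  (ψ≢x₂ : ∀ w → ψ w ≢ x₂) (ψ≢y₂ : ∀ w → ψ w ≢ y₂)
                  (x≢y : ∀ i j → (x₁ V.∷ x₂ V.∷ V.[]) i ≢ (y₁ V.∷ y₂ V.∷ V.[]) j)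
                  (bi₁ : c x₁ a ≢ c x₂ a) (bi₂ : c y₁ b ≢ c y₂ b) where

    x y : Fin 2 → Fin N
    x = x₁ V.∷ x₂ V.∷ V.[]
    y = y₁ V.∷ y₂ V.∷ V.[]

    private
      u≢v : u ≢ v
      u≢v with (u≢v ∷ _) ∷ _ ← distinct = u≢v
      u′≢u : u′ ≢ u
      u′≢u with (_ ∷ u≢u′ ∷ _) ∷ _ ← distinct = ≢-sym u≢u′
      v′≢u : v′ ≢ u
      v′≢u with (_ ∷ _ ∷ u≢v′ ∷ _) ∷ _ ← distinct = ≢-sym u≢v′
      u′≢v : u′ ≢ v
      u′≢v with _ ∷ (v≢u′ ∷ _) ∷ _ ← distinct = ≢-sym v≢u′
      v′≢v : v′ ≢ v
      v′≢v with _ ∷ (_ ∷ v≢v′ ∷ _) ∷ _ ← distinct = ≢-sym v≢v′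

    φ : Fin 2 → Fin 2 → Fin n → Fin N
    φ i j = updateAt (updateAt ψ u (const (x i))) v (const (y j))

    φ-off : ∀ i j {w} → w ≢ u → w ≢ v → φ i j w ≡ ψ w
    φ-off i j {w} w≢u w≢v = trans (updateAt-minimal w v _ w≢v) (updateAt-minimal w u ψ w≢u)

    φ-injective : ∀ i j → Injective _≡_ _≡_ (φ i j)
    φ-injective i j = updateAt-injective (updateAt-injective ψ-injective (ψ⁻¹x i)) preimage-y
      where
        ψ⁻¹x : ∀ i w → ψ w ≡ x i → w ≡ u
        ψ⁻¹x zero       w eq = ψ-injective (trans eq (sym ψu≡x₁))
        ψ⁻¹x (suc zero) w eq = contradiction eq (ψ≢x₂ w)
        ψ⁻¹y : ∀ j w → ψ w ≡ y j → w ≡ v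
        ψ⁻¹y zero       w eq = ψ-injective (trans eq (sym ψv≡y₁))
        ψ⁻¹y (suc zero) w eq = contradiction eq (ψ≢y₂ w)
        preimage-y : ∀ w → updateAt ψ u (const (x i)) w ≡ y j → w ≡ v
        preimage-y w eq with w ≟ u
        ... | yes refl = contradiction (trans (sym (updateAt-updates u ψ)) eq) (x≢y i j)
        ... | no w≢u   = ψ⁻¹y j w (trans (sym (updateAt-minimal w u ψ w≢u)) eq)

    R : ℕ
    R = edgeSum G ((weight ψ without v) without u)

    edgeSum-φ : ∀ i j → edgeSum G (weight (φ i j)) ≡ R + (toℕ (c (x i) a) + toℕ (c (y j) b))
    edgeSum-φ i j = begin
      edgeSum G (weight (φ i j))
        ≡⟨ pendants-split G P (weight (φ i j)) (weight-sym (φ i j)) ⟩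
      edgeSum G ((weight (φ i j) without v) without u) + weight (φ i j) u u′ + weight (φ i j) v v′
        ≡⟨ cong (λ r → r + weight (φ i j) u u′ + weight (φ i j) v v′) (edgeSum-cong G λ k l _ → leaves-removed k l) ⟩
      R + weight (φ i j) u u′ + weight (φ i j) v v′
        ≡⟨ +-assoc R _ _ ⟩
      R + (toℕ (c (φ i j u) (φ i j u′)) + toℕ (c (φ i j v) (φ i j v′)))
        ≡⟨ cong₂ (λ p q → R + (toℕ p + toℕ q)) (cong₂ c φ-u (trans (φ-off i j u′≢u u′≢v) ψu′≡a))
                                                (cong₂ c φ-v (trans (φ-off i j v′≢u v′≢v) ψv′≡b)) ⟩
      R + (toℕ (c (x i) a) + toℕ (c (y j) b))
        ∎
      where
        open ≡-Reasoning
        φ-u : φ i j u ≡ x i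
        φ-u = trans (updateAt-minimal u v _ u≢v) (updateAt-updates u ψ)
        φ-v : φ i j v ≡ y j
        φ-v = updateAt-updates v _
        leaves-removed : ∀ k l → ((weight (φ i j) without v) without u) k l ≡ ((weight ψ without v) without u) k l
        leaves-removed k l = without-cong (weight (φ i j) without v) u {weight ψ without v} {k} {l} λ k≢u l≢u →
                             without-cong (weight (φ i j)) v {weight ψ} {k} {l} λ k≢v l≢v →
          cong₂ (λ p q → toℕ (c p q)) (φ-off i j k≢u k≢v) (φ-off i j l≢u l≢v)

    copy : ZeroSumCopy G N c
    copy with ℤ₃-choice R (λ i → c (x i) a) (λ j → c (y j) b) bi₁ bi₂
    ... | i , j , ≡0 = φ i j , φ-injective i j , trans (cong (_% 3) (edgeSum-φ i j)) ≡0

  copy-from-cherries : TwoDisjointCherries → ZeroSumCopy G N c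
  copy-from-cherries (C₁@(cherry a x₁ x₂ _ _ bi₁) , C₂@(cherry b y₁ y₂ _ _ bi₂) ,
                      (b≢a ∷ b≢x₁ ∷ b≢x₂ ∷ []) ∷ (y₁≢a ∷ y₁≢x₁ ∷ y₁≢x₂ ∷ []) ∷ (y₂≢a ∷ y₂≢x₁ ∷ y₂≢x₂ ∷ []) ∷ [])
    with embedding-avoiding n+2≤N (u ∷ v ∷ u′ ∷ v′ ∷ []) (x₁ ∷ y₁ ∷ a ∷ b ∷ []) refl distinct
           ((≢-sym y₂≢x₂ ∷ ≢-sym (Cherry.leaf₁≢leaf₂ C₁) ∷ ≢-sym y₁≢x₂ ∷ ≢-sym (Cherry.centre≢leaf₂ C₁) ∷ ≢-sym b≢x₂ ∷ []) ∷
            (y₂≢x₁ ∷ ≢-sym (Cherry.leaf₁≢leaf₂ C₂) ∷ y₂≢a ∷ ≢-sym (Cherry.centre≢leaf₂ C₂) ∷ []) ∷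
            (≢-sym y₁≢x₁ ∷ ≢-sym (Cherry.centre≢leaf₁ C₁) ∷ ≢-sym b≢x₁ ∷ []) ∷
            (y₁≢a ∷ ≢-sym (Cherry.centre≢leaf₁ C₂) ∷ []) ∷
            (≢-sym b≢a ∷ []) ∷ [] ∷ [])
  ... | ψ , ψ-injective , (ψu≡x₁ ∷ ψv≡y₁ ∷ ψu′≡a ∷ ψv′≡b ∷ []) , ψ≢x₂ , ψ≢y₂ =
    Swapping.copy ψ ψ-injective ψu≡x₁ ψv≡y₁ ψu′≡a ψv′≡b ψ≢x₂ ψ≢y₂ x≢y (swap-ends bi₁) (swap-ends bi₂)
    where
      x≢y : ∀ i j → (x₁ V.∷ x₂ V.∷ V.[]) i ≢ (y₁ V.∷ y₂ V.∷ V.[]) j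
      x≢y zero       zero       = ≢-sym y₁≢x₁
      x≢y zero       (suc zero) = ≢-sym y₂≢x₁
      x≢y (suc zero) zero       = ≢-sym y₁≢x₂
      x≢y (suc zero) (suc zero) = ≢-sym y₂≢x₂
      swap-ends : ∀ {o z₁ z₂} → c o z₁ ≢ c o z₂ → c z₁ o ≢ c z₂ o
      swap-ends {o} {z₁} {z₂} bi eq = bi (trans (c-sym o z₁) (trans eq (c-sym z₂ o)))

  copy : edgeCount G % 3 ≡ 0 → ZeroSumCopy G N c
  copy e≡0 with cherries-or-almostMonochromatic 6≤N
    where
      6≤N : 6 ≤ N
      6≤N = ≤-trans (+-monoˡ-≤ 2 (Distinct⇒length≤ distinct)) n+2≤N
  ... | inj₁ cherries = copy-from-cherries cherries
  ... | inj₂ almost   = copy-from-almostMonochromatic e≡0 almost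

upper-bound : ∀ {n} (G : Graph n) → TwoGood G → edgeCount G % 3 ≡ 0 → RThreshold G (n + 2)
upper-bound G good e≡0 N n+2≤N (c , c-sym) = UpperBound.copy G (twoGood⇒pendantPair G good) n+2≤N c c-sym e≡0

marked : ∀ {m} → Fin (2 + m) → ℕ
marked zero          = 1
marked (suc zero)    = 1
marked (suc (suc _)) = 0

marked≤1 : ∀ {m} (p : Fin (2 + m)) → marked p ≤ 1
marked≤1 zero          = ≤-refl
marked≤1 (suc zero)    = ≤-refl
marked≤1 (suc (suc _)) = z≤n

marked-≟ : ∀ {m} (p : Fin (2 + m)) → marked p ≡ 𝟙 ⌊ p ≟ zero ⌋ + 𝟙 ⌊ p ≟ suc zero ⌋
marked-≟ zero          = refl
marked-≟ (suc zero)    = refl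
marked-≟ (suc (suc _)) = refl

markedColour : ∀ {m} → Fin (2 + m) → Fin (2 + m) → Fin 3
markedColour p q = fromℕ< (s≤s (+-mono-≤ (marked≤1 p) (marked≤1 q)))

toℕ-markedColour : ∀ {m} (p q : Fin (2 + m)) → toℕ (markedColour p q) ≡ marked p + marked q
toℕ-markedColour p q = toℕ-fromℕ< _

markedColour-sym : ∀ {m} (p q : Fin (2 + m)) → markedColour p q ≡ markedColour q p
markedColour-sym p q = toℕ-injective (begin
  toℕ (markedColour p q)  ≡⟨ toℕ-markedColour p q ⟩
  marked p + marked q     ≡⟨ +-comm (marked p) (marked q) ⟩
  marked q + marked p     ≡⟨ toℕ-markedColour q p ⟨
  toℕ (markedColour q p)  ∎)
  where open ≡-Reasoning

𝟙-yes : ∀ {P : Set} (d : Dec P) → P → 𝟙 ⌊ d ⌋ ≡ 1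
𝟙-yes (yes _) _  = refl
𝟙-yes (no ¬p) p = contradiction p ¬p

𝟙-no : ∀ {P : Set} (d : Dec P) → ¬ P → 𝟙 ⌊ d ⌋ ≡ 0
𝟙-no (yes p) ¬p = contradiction p ¬p
𝟙-no (no _)  _  = refl

module _ {n N : ℕ} {φ : Fin n → Fin N} (φ-injective : Injective _≡_ _≡_ φ) where

  hits : Fin N → ℕ
  hits z = ∑[ v < n ] 𝟙 ⌊ φ v ≟ z ⌋

  hits≤1 : ∀ z → hits z ≤ 1
  hits≤1 z with any? (λ v → φ v ≟ z)
  ... | yes (p , φp≡z) = ≤-reflexive (trans (∑-single _ p missed) (𝟙-yes (φ p ≟ z) φp≡z))
    where
      missed : ∀ v → v ≢ p → 𝟙 ⌊ φ v ≟ z ⌋ ≡ 0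
      missed v v≢p = 𝟙-no (φ v ≟ z) (λ φv≡z → v≢p (φ-injective (trans φv≡z (sym φp≡z))))
  ... | no ∄p = ≤-trans (≤-reflexive (∑-zero _ λ v → 𝟙-no (φ v ≟ z) (λ φv≡z → ∄p (v , φv≡z)))) z≤n

  hit⇒1≤hits : ∀ {p z} → φ p ≡ z → 1 ≤ hits z
  hit⇒1≤hits {p} {z} φp≡z = subst (_≤ hits z) (𝟙-yes (φ p ≟ z) φp≡z) (term≤∑ _ p)

marked-hit : ∀ {m} {φ : Fin (suc m) → Fin (2 + m)} (φ-injective : Injective _≡_ _≡_ φ) →
             1 ≤ hits φ-injective zero + hits φ-injective (suc zero)
marked-hit {m} {φ} φ-injective with any? (λ v → φ v ≟ zero) | any? (λ v → φ v ≟ suc zero)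
... | yes (_ , φp≡0) | _              = ≤-trans (hit⇒1≤hits φ-injective φp≡0) (m≤m+n _ _)
... | no _           | yes (_ , φp≡1) = ≤-trans (hit⇒1≤hits φ-injective φp≡1) (m≤n+m _ (hits φ-injective zero))
... | no ∄p₀         | no ∄p₁         = contradiction (injective⇒≤ shifted-injective) 1+n≰n
  where
    two-up : ∀ (q : Fin (2 + m)) → q ≢ zero → q ≢ suc zero → ∃ λ k → q ≡ suc (suc k)
    two-up zero          q≢0 _   = contradiction refl q≢0
    two-up (suc zero)    _   q≢1 = contradiction refl q≢1
    two-up (suc (suc k)) _   _   = k , refl
    shifted : ∀ v → ∃ λ k → φ v ≡ suc (suc k)
    shifted v = two-up (φ v) (λ φv≡0 → ∄p₀ (v , φv≡0)) (λ φv≡1 → ∄p₁ (v , φv≡1))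
    shifted-injective : Injective _≡_ _≡_ (proj₁ ∘ shifted)
    shifted-injective {v} {v′} eq =
      φ-injective (trans (proj₂ (shifted v)) (trans (cong (λ k → suc (suc k)) eq) (sym (proj₂ (shifted v′)))))

[d*f]%m≡f%m : ∀ m .{{_ : NonZero m}} {d} f → d % m ≡ 1 → (d * f) % m ≡ f % m
[d*f]%m≡f%m m {d} f d≡1 = begin
  (d * f) % m              ≡⟨ %-distribˡ-* d f m ⟩
  (d % m * (f % m)) % m    ≡⟨ cong (λ r → (r * (f % m)) % m) d≡1 ⟩
  (1 * (f % m)) % m        ≡⟨ cong (_% m) (*-identityˡ (f % m)) ⟩
  f % m % m                ≡⟨ m%n%n≡m%n f m ⟩
  f % m                    ∎
  where open ≡-Reasoning

[a+b]%3≢0 : ∀ {a b} → a ≤ 1 → b ≤ 1 → 1 ≤ a + b → (a + b) % 3 ≢ 0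
[a+b]%3≢0 z≤n       z≤n       ()
[a+b]%3≢0 z≤n       (s≤s z≤n) _ ()
[a+b]%3≢0 (s≤s z≤n) z≤n       _ ()
[a+b]%3≢0 (s≤s z≤n) (s≤s z≤n) _ ()

no-zeroSumCopy-marked : ∀ {m} (G : Graph (suc m)) → (∀ v → degree G v % 3 ≡ 1) →
                        ¬ ZeroSumCopy G (2 + m) markedColour
no-zeroSumCopy-marked {m} G deg≡1 (φ , φ-injective , sum≡0) =
  [a+b]%3≢0 (hits≤1 φ-injective zero) (hits≤1 φ-injective (suc zero)) (marked-hit φ-injective) (begin
    (hits φ-injective zero + hits φ-injective (suc zero)) % 3
      ≡⟨ cong (_% 3) (∑-distrib-+ (λ v → 𝟙 ⌊ φ v ≟ zero ⌋) (λ v → 𝟙 ⌊ φ v ≟ suc zero ⌋)) ⟨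
    (∑[ v < suc m ] (𝟙 ⌊ φ v ≟ zero ⌋ + 𝟙 ⌊ φ v ≟ suc zero ⌋)) % 3
      ≡⟨ cong (_% 3) (sum-cong-≗ (marked-≟ ∘ φ)) ⟨
    (∑[ v < suc m ] marked (φ v)) % 3
      ≡⟨ ∑-cong-% 3 (λ v → degree G v * marked (φ v)) (marked ∘ φ)
                    (λ v → [d*f]%m≡f%m 3 {degree G v} (marked (φ v)) (deg≡1 v)) ⟨
    (∑[ v < suc m ] (degree G v * marked (φ v))) % 3
      ≡⟨ cong (_% 3) (handshake G (marked ∘ φ)) ⟨
    edgeSum G (λ i j → marked (φ i) + marked (φ j)) % 3
      ≡⟨ cong (_% 3) (edgeSum-cong G λ i j _ → toℕ-markedColour (φ i) (φ j)) ⟨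
    edgeSum G (λ i j → toℕ (markedColour (φ i) (φ j))) % 3
      ≡⟨ sum≡0 ⟩
    0 ∎)
  where open ≡-Reasoning

corollary10 : (n : ℕ) (G : Graph n) → TwoGood G → edgeCount G % 3 ≡ 0
    → (∀ v → degree G v % 3 ≡ 1) → IsRZ3 G (n + 2)
corollary10 zero    G (() , _) _ _
corollary10 (suc m) G good e≡0 deg≡1 = s≤s z≤n , upper-bound G good e≡0 , minimal
  where
    minimal : ∀ r′ → 0 < r′ → RThreshold G r′ → suc m + 2 ≤ r′
    minimal r′ _ threshold = subst (_≤ r′) (+-comm 2 (suc m)) (≮⇒≥ λ r′<2+n →
      no-zeroSumCopy-marked G deg≡1 (threshold (2 + m) (s≤s⁻¹ r′<2+n) (markedColour , markedColour-sym)))
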